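{- Let $w \ge d \ge 1$ be integers. For any integer $j$ with $0 \le j \le d$, $$\binom{w}{j}\binom{w+d-2j}{d-j} \le \frac{\left(w + \frac{d}{2} + \frac{1}{2}\right)^{d-j}\left(w - \frac{d}{2} + \frac{3}{2}\right)^{j}}{j!\,(d-j)!}.$$ -}

module Defs where

open import Data.Nat using (ℕ; zero; suc)
open import Data.Rational using (ℚ; 1ℚ; _*_)

infixr 8 _^ℚ_
_^ℚ_ : ℚ → ℕ → ℚ
p ^ℚ zero = 1ℚ
p ^ℚ suc n = p * (p ^ℚ n)

{-# OPTIONS --safe #-}
-- Write d = j + k and w = d + v, and put u = w - j = k + v.  Then C(w,j)·j! and
-- C(w+d-2j, d-j)·k! are the rising products (u+1)⋯(u+j) and (u+1)⋯(u+k);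
-- pairing their factors from both ends (AM-GM) bounds them by ((2u+j+1)/2)^j
-- and ((2u+k+1)/2)^k.  The means in the statement are (2w+d+1)/2, larger than
-- (2u+k+1)/2 by 3j/2, and (2w-d+3)/2, smaller than (2u+j+1)/2 by (k-2)/2; a
-- Bernoulli-type inequality shows that the gain on the k-fold power pays for
-- the loss on the j-fold power.  After multiplying by 2^d·j!·k! all of this is
-- an inequality between natural numbers.
module Submission where

module NaturalBound where

  open import Data.Nat
  open import Data.Nat.Properties
  open import Data.Nat.Combinatorics using (_C_; nCk≡n!/k![n-k]!; k![n∸k]!∣n!)
  open import Data.Nat.DivMod using (m/n*n≡m)
  open import Data.List using (_∷_; [])
  open import Data.Nat.Tactic.RingSolver using (solve; solve-∀)
  open import Relation.Binary.PropositionalEquality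

  m+n≡o⇒m≤o : ∀ {m n o} → m + n ≡ o → m ≤ o
  m+n≡o⇒m≤o {m} {n} refl = m≤m+n m n

  risingFactorial : ℕ → ℕ → ℕ
  risingFactorial a zero    = 1
  risingFactorial a (suc n) = a * risingFactorial (suc a) n

  risingFactorial-last : ∀ a n → risingFactorial a (suc n) ≡ risingFactorial a n * (a + n)
  risingFactorial-last a zero    = solve (a ∷ [])
  risingFactorial-last a (suc n) = begin
    a * risingFactorial (suc a) (suc n)           ≡⟨ cong (a *_) (risingFactorial-last (suc a) n) ⟩
    a * (risingFactorial (suc a) n * (suc a + n)) ≡⟨ rearrange a (risingFactorial (suc a) n) n ⟩
    a * risingFactorial (suc a) n * (a + suc n)   ∎
    where
    open ≡-Reasoning
    rearrange : ∀ a r n → a * (r * (suc a + n)) ≡ a * r * (a + suc n)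
    rearrange = solve-∀

  risingFactorial*!≡! : ∀ m n → risingFactorial (suc m) n * m ! ≡ (m + n) !
  risingFactorial*!≡! m zero    = trans (*-identityˡ (m !)) (cong _! (sym (+-identityʳ m)))
  risingFactorial*!≡! m (suc n) = begin
    suc m * risingFactorial (suc (suc m)) n * m ! ≡⟨ rearrange (suc m) (risingFactorial (suc (suc m)) n) (m !) ⟩
    risingFactorial (suc (suc m)) n * (suc m) !   ≡⟨ risingFactorial*!≡! (suc m) n ⟩
    (suc m + n) !                                 ≡⟨ cong _! (sym (+-suc m n)) ⟩
    (m + suc n) !                                 ∎
    where
    open ≡-Reasoning
    rearrange : ∀ a r f → a * r * f ≡ r * (a * f)
    rearrange = solve-∀

  nCk*[k!*[n∸k]!]≡n! : ∀ {n k} → k ≤ n → (n C k) * (k ! * (n ∸ k) !) ≡ n !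
  nCk*[k!*[n∸k]!]≡n! {n} {k} k≤n = begin
    (n C k) * (k ! * (n ∸ k) !)             ≡⟨ cong (_* (k ! * (n ∸ k) !)) (nCk≡n!/k![n-k]! k≤n) ⟩
    (n ! / (k ! * (n ∸ k) !)) * (k ! * (n ∸ k) !) ≡⟨ m/n*n≡m (k![n∸k]!∣n! k≤n) ⟩
    n !                                     ∎
    where
    open ≡-Reasoning
    instance _ = k !* (n ∸ k) !≢0

  [m+n]Cn*n!≡risingFactorial : ∀ m n → ((m + n) C n) * n ! ≡ risingFactorial (suc m) n
  [m+n]Cn*n!≡risingFactorial m n = *-cancelʳ-≡ _ _ (m !) {{m !≢0}} (begin
    ((m + n) C n) * n ! * m !              ≡⟨ *-assoc ((m + n) C n) (n !) (m !) ⟩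
    ((m + n) C n) * (n ! * m !)            ≡⟨ cong (λ k → ((m + n) C n) * (n ! * k !)) (sym (m+n∸n≡m m n)) ⟩
    ((m + n) C n) * (n ! * (m + n ∸ n) !)  ≡⟨ nCk*[k!*[n∸k]!]≡n! (m≤n+m n m) ⟩
    (m + n) !                              ≡⟨ sym (risingFactorial*!≡! m n) ⟩
    risingFactorial (suc m) n * m !        ∎)
    where open ≡-Reasoning

  2^n*risingFactorial≤[2m+n+1]^n : ∀ m n → 2 ^ n * risingFactorial (suc m) n ≤ (2 * m + n + 1) ^ n
  2^n*risingFactorial≤[2m+n+1]^n m zero          = ≤-refl
  2^n*risingFactorial≤[2m+n+1]^n m (suc zero)    = ≤-reflexive (single-factor m)
    where
    single-factor : ∀ m → 2 * 1 * (suc m * 1) ≡ (2 * m + 1 + 1) * 1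
    single-factor = solve-∀
  2^n*risingFactorial≤[2m+n+1]^n m (suc (suc n)) = begin
    2 ^ (2 + n) * risingFactorial (suc m) (2 + n)
      ≡⟨ cong (λ r → 2 ^ (2 + n) * (suc m * r)) (risingFactorial-last (2 + m) n) ⟩
    2 ^ (2 + n) * (suc m * (inner * (2 + m + n)))
      ≡⟨ rearrange (2 ^ n) inner m n ⟩
    (4 * (1 + m) * (2 + m + n)) * (2 ^ n * inner)
      ≤⟨ *-mono-≤ outer-pair≤square (2^n*risingFactorial≤[2m+n+1]^n (suc m) n) ⟩
    (X * X) * (2 * suc m + n + 1) ^ n
      ≡⟨ cong (λ y → (X * X) * y ^ n) (same-mean m n) ⟩
    (X * X) * X ^ n
      ≡⟨ *-assoc X X (X ^ n) ⟩
    X ^ (2 + n) ∎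
    where
    open ≤-Reasoning
    inner = risingFactorial (2 + m) n
    X = 2 * m + (2 + n) + 1
    rearrange : ∀ p r m n → 2 * (2 * p) * (suc m * (r * (2 + m + n))) ≡ (4 * (1 + m) * (2 + m + n)) * (p * r)
    rearrange = solve-∀
    same-mean : ∀ m n → 2 * suc m + n + 1 ≡ 2 * m + (2 + n) + 1
    same-mean = solve-∀
    outer-pair≤square : 4 * (1 + m) * (2 + m + n) ≤ X * X
    outer-pair≤square = m+n≡o⇒m≤o (square-expansion m n)
      where
      square-expansion : ∀ m n → 4 * (1 + m) * (2 + m + n) + (n + 1) * (n + 1)
                               ≡ (2 * m + (2 + n) + 1) * (2 * m + (2 + n) + 1)
      square-expansion = solve-∀

  ^-distribʳ-* : ∀ m n k → (m * n) ^ k ≡ m ^ k * n ^ k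
  ^-distribʳ-* m n zero    = refl
  ^-distribʳ-* m n (suc k) = trans (cong (m * n *_) (^-distribʳ-* m n k)) (interchange m n (m ^ k) (n ^ k))
    where open import Algebra.Properties.CommutativeSemigroup *-commutativeSemigroup using (interchange)

  cross-mul-≤ : ∀ X Z p q → q * X ≤ p * Z → X * (Z + q) ≤ (X + p) * Z
  cross-mul-≤ X Z p q qX≤pZ = begin
    X * (Z + q)   ≡⟨ solve (X ∷ Z ∷ q ∷ []) ⟩
    X * Z + q * X ≤⟨ +-monoʳ-≤ (X * Z) qX≤pZ ⟩
    X * Z + p * Z ≡⟨ solve (X ∷ Z ∷ p ∷ []) ⟩
    (X + p) * Z   ∎
    where open ≤-Reasoning

  -- (1 + p/X)^k ≥ 1 + k·p/X ≥ 1 + k·q/Z, cleared of denominators.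
  bernoulli-≤ : ∀ k X Z p q → q * X ≤ p * Z → X ^ k * (Z + q * k) ≤ (X + p) ^ k * Z
  bernoulli-≤ zero    X Z p q _     = ≤-reflexive (cong (1 *_) (trans (cong (Z +_) (*-zeroʳ q)) (+-identityʳ Z)))
  bernoulli-≤ (suc k) X Z p q qX≤pZ = begin
    X * X ^ k * (Z + q * suc k)       ≡⟨ rearrange X (X ^ k) Z q k ⟩
    X * (X ^ k * ((Z + q) + q * k))   ≤⟨ *-monoʳ-≤ X (bernoulli-≤ k X (Z + q) p q qX≤p[Z+q]) ⟩
    X * ((X + p) ^ k * (Z + q))       ≡⟨ x∙yz≈y∙xz X ((X + p) ^ k) (Z + q) ⟩
    (X + p) ^ k * (X * (Z + q))       ≤⟨ *-monoʳ-≤ ((X + p) ^ k) (cross-mul-≤ X Z p q qX≤pZ) ⟩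
    (X + p) ^ k * ((X + p) * Z)       ≡⟨ x∙yz≈y∙xz ((X + p) ^ k) (X + p) Z ⟩
    (X + p) * ((X + p) ^ k * Z)       ≡⟨ *-assoc (X + p) ((X + p) ^ k) Z ⟨
    (X + p) * (X + p) ^ k * Z         ∎
    where
    open ≤-Reasoning
    open import Algebra.Properties.CommutativeSemigroup *-commutativeSemigroup using (x∙yz≈y∙xz)
    qX≤p[Z+q] : q * X ≤ p * (Z + q)
    qX≤p[Z+q] = ≤-trans qX≤pZ (*-monoʳ-≤ p (m≤m+n Z q))
    rearrange : ∀ X Y Z q k → X * Y * (Z + q * suc k) ≡ X * (Y * ((Z + q) + q * k))
    rearrange = solve-∀

  -- (1 + q·k/Z)^j ≤ (1 + p·j/X)^k: one use of bernoulli-≤ per factor of the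
  -- j-fold power, with X growing by p each time.
  bernoulli-^-≤ : ∀ k j X Z p q → q * (X + p * j) ≤ p * Z →
                  X ^ k * (Z + q * k) ^ j ≤ (X + p * j) ^ k * Z ^ j
  bernoulli-^-≤ k zero    X Z p q _ =
    ≤-reflexive (cong (λ Y → Y ^ k * 1) (sym (trans (cong (X +_) (*-zeroʳ p)) (+-identityʳ X))))
  bernoulli-^-≤ k (suc j) X Z p q q[X+p[1+j]]≤pZ = begin
    X ^ k * (Z + q * k) ^ suc j             ≡⟨ x∙yz≈z∙xy (X ^ k) (Z + q * k) ((Z + q * k) ^ j) ⟩
    (Z + q * k) ^ j * (X ^ k * (Z + q * k)) ≤⟨ *-monoʳ-≤ ((Z + q * k) ^ j) (bernoulli-≤ k X Z p q qX≤pZ) ⟩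
    (Z + q * k) ^ j * ((X + p) ^ k * Z)     ≡⟨ x∙yz≈z∙yx ((Z + q * k) ^ j) ((X + p) ^ k) Z ⟩
    Z * ((X + p) ^ k * (Z + q * k) ^ j)     ≤⟨ *-monoʳ-≤ Z (bernoulli-^-≤ k j (X + p) Z p q q[X+p+pj]≤pZ) ⟩
    Z * ((X + p + p * j) ^ k * Z ^ j)       ≡⟨ cong (λ Y → Z * (Y ^ k * Z ^ j)) X+p+pj≡X+p[1+j] ⟩
    Z * ((X + p * suc j) ^ k * Z ^ j)       ≡⟨ x∙yz≈y∙xz Z ((X + p * suc j) ^ k) (Z ^ j) ⟩
    (X + p * suc j) ^ k * Z ^ suc j         ∎
    where
    open ≤-Reasoning
    open import Algebra.Properties.CommutativeSemigroup *-commutativeSemigroup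
      using (x∙yz≈y∙xz; x∙yz≈z∙xy; x∙yz≈z∙yx)
    X+p+pj≡X+p[1+j] : X + p + p * j ≡ X + p * suc j
    X+p+pj≡X+p[1+j] = solve (X ∷ p ∷ j ∷ [])
    qX≤pZ : q * X ≤ p * Z
    qX≤pZ = ≤-trans (*-monoʳ-≤ q (m≤m+n X (p * suc j))) q[X+p[1+j]]≤pZ
    q[X+p+pj]≤pZ : q * (X + p + p * j) ≤ p * Z
    q[X+p+pj]≤pZ = subst (λ Y → q * Y ≤ p * Z) (sym X+p+pj≡X+p[1+j]) q[X+p[1+j]]≤pZ

  -- For k ≥ 2 this is bernoulli-^-≤ with p = 3 and q = k - 2, once the j-fold
  -- base is scaled by k so that its excess k - 2 becomes q·k.
  rebalance-≤ : ∀ j k v → (2 * (k + v) + k + 1) ^ k * (2 * (k + v) + j + 1) ^ j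
                        ≤ (2 * (j + k + v) + (j + k) + 1) ^ k * (2 * v + k + j + 3) ^ j
  rebalance-≤ j zero v = *-monoʳ-≤ 1 (^-monoˡ-≤ j N≤B)
    where
    N≤B : 2 * (0 + v) + j + 1 ≤ 2 * v + 0 + j + 3
    N≤B = m+n≡o⇒m≤o {n = 2} (solve (j ∷ v ∷ []))
  rebalance-≤ j (suc zero) v = *-mono-≤ (^-monoˡ-≤ 1 M≤A) (^-monoˡ-≤ j N≤B)
    where
    M≤A : 2 * (1 + v) + 1 + 1 ≤ 2 * (j + 1 + v) + (j + 1) + 1
    M≤A = m+n≡o⇒m≤o {n = 3 * j} (solve (j ∷ v ∷ []))
    N≤B : 2 * (1 + v) + j + 1 ≤ 2 * v + 1 + j + 3
    N≤B = m+n≡o⇒m≤o {n = 1} (solve (j ∷ v ∷ []))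
  rebalance-≤ j k@(suc (suc c)) v = *-cancelˡ-≤ (k ^ j) {{m^n≢0 k j}} (begin
    k ^ j * (M ^ k * N ^ j)     ≡⟨ x∙yz≈y∙xz (k ^ j) (M ^ k) (N ^ j) ⟩
    M ^ k * (k ^ j * N ^ j)     ≡⟨ cong (M ^ k *_) (^-distribʳ-* k N j) ⟨
    M ^ k * (k * N) ^ j         ≡⟨ cong (λ Y → M ^ k * Y ^ j) (kN≡kB+ck c v j) ⟩
    M ^ k * (k * B + c * k) ^ j ≤⟨ bernoulli-^-≤ k j M (k * B) 3 c c[M+3j]≤3kB ⟩
    (M + 3 * j) ^ k * (k * B) ^ j ≡⟨ cong₂ (λ X Y → X ^ k * Y) (M+3j≡A c v j) (^-distribʳ-* k B j) ⟩
    A ^ k * (k ^ j * B ^ j)     ≡⟨ x∙yz≈y∙xz (A ^ k) (k ^ j) (B ^ j) ⟩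
    k ^ j * (A ^ k * B ^ j)     ∎)
    where
    open ≤-Reasoning
    open import Algebra.Properties.CommutativeSemigroup *-commutativeSemigroup using (x∙yz≈y∙xz)
    M = 2 * (k + v) + k + 1
    N = 2 * (k + v) + j + 1
    A = 2 * (j + k + v) + (j + k) + 1
    B = 2 * v + k + j + 3
    kN≡kB+ck : ∀ c v j → (2 + c) * (2 * (2 + c + v) + j + 1)
                       ≡ (2 + c) * (2 * v + (2 + c) + j + 3) + c * (2 + c)
    kN≡kB+ck = solve-∀
    M+3j≡A : ∀ c v j → 2 * (2 + c + v) + (2 + c) + 1 + 3 * j
                     ≡ 2 * (j + (2 + c) + v) + (j + (2 + c)) + 1
    M+3j≡A = solve-∀
    slack : ∀ c v j → c * (2 * (2 + c + v) + (2 + c) + 1 + 3 * j)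
                        + (4 * c * v + 14 * c + 12 * v + 6 * j + 30)
                    ≡ 3 * ((2 + c) * (2 * v + (2 + c) + j + 3))
    slack = solve-∀
    c[M+3j]≤3kB : c * (M + 3 * j) ≤ 3 * (k * B)
    c[M+3j]≤3kB = m+n≡o⇒m≤o (slack c v j)

  binomial-product-bound : ∀ j k v →
    ((j + k + v) C j) * ((k + v + k) C k) * (2 ^ k * 2 ^ j * (j ! * k !))
      ≤ (2 * (j + k + v) + (j + k) + 1) ^ k * (2 * v + k + j + 3) ^ j
  binomial-product-bound j k v = begin
    ((j + k + v) C j) * Ck * (2 ^ k * 2 ^ j * (j ! * k !))
      ≡⟨ cong (λ n → (n C j) * Ck * (2 ^ k * 2 ^ j * (j ! * k !))) w≡u+j ⟩
    Cj * Ck * (2 ^ k * 2 ^ j * (j ! * k !))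
      ≡⟨ rearrange Cj Ck (2 ^ k) (2 ^ j) (j !) (k !) ⟩
    (2 ^ k * (Ck * k !)) * (2 ^ j * (Cj * j !))
      ≡⟨ cong₂ (λ x y → (2 ^ k * x) * (2 ^ j * y))
               ([m+n]Cn*n!≡risingFactorial u k) ([m+n]Cn*n!≡risingFactorial u j) ⟩
    (2 ^ k * risingFactorial (suc u) k) * (2 ^ j * risingFactorial (suc u) j)
      ≤⟨ *-mono-≤ (2^n*risingFactorial≤[2m+n+1]^n u k) (2^n*risingFactorial≤[2m+n+1]^n u j) ⟩
    (2 * u + k + 1) ^ k * (2 * u + j + 1) ^ j
      ≤⟨ rebalance-≤ j k v ⟩
    (2 * (j + k + v) + (j + k) + 1) ^ k * (2 * v + k + j + 3) ^ j ∎
    where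
    open ≤-Reasoning
    u = k + v
    Cj = (u + j) C j
    Ck = (u + k) C k
    w≡u+j : j + k + v ≡ k + v + j
    w≡u+j = solve (j ∷ k ∷ v ∷ [])
    rearrange : ∀ a b p q x y → a * b * (p * q * (x * y)) ≡ (p * (b * y)) * (q * (a * x))
    rearrange = solve-∀

  [j+k+v]+[j+k]∸2j≡k+v+k : ∀ j k v → j + k + v + (j + k) ∸ 2 * j ≡ k + v + k
  [j+k+v]+[j+k]∸2j≡k+v+k j k v = trans (cong (_∸ 2 * j) reorder) (m+n∸n≡m (k + v + k) (2 * j))
    where
    reorder : j + k + v + (j + k) ≡ k + v + k + 2 * j
    reorder = solve (j ∷ k ∷ v ∷ [])

open import Defs
open import Data.Nat using (ℕ; _≤_; _∸_; _!)
open import Data.Nat.Properties using (_!*_!≢0)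
open import Data.Nat.Combinatorics using (_C_)
open import Data.Integer using (+_)
open import Data.Rational using (ℚ; _/_; _+_; _-_; _*_)
open import Data.Rational using () renaming (_≤_ to _≤ℚ_)
open import Data.Nat using () renaming (_+_ to _+ℕ_; _*_ to _*ℕ_)

open import Level using (0ℓ)
open import Data.Nat using (zero; suc; NonZero) renaming (_^_ to _^ℕ_)
import Data.Nat.Properties as ℕ
import Data.Nat.Tactic.RingSolver as ℕ-Solver
open import Data.Product using (_,_)
import Data.Integer as ℤ
import Data.Integer.Properties as ℤ
open import Data.Rational using (0ℚ; 1ℚ; toℚᵘ; *≤*)
open import Data.Rational.Literals using (fromℤ)
open import Data.Rational.Properties
  using (_≟_; ↥p/↧p≡p; toℚᵘ-injective; toℚᵘ-fromℚᵘ; toℚᵘ-homo-*; normalize-pos;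
         *-identityʳ; *-cancelʳ-≤-pos; +-*-commutativeRing; module ≤-Reasoning)
open import Data.Rational.Unnormalised as ℚᵘ using (mkℚᵘ; *≡*)
import Data.Rational.Unnormalised.Properties as ℚᵘ
open import Relation.Binary.PropositionalEquality
open import Relation.Nullary.Decidable using (dec⇒maybe)
open import Tactic.RingSolver.Core.AlmostCommutativeRing using (AlmostCommutativeRing; fromCommutativeRing)
open import Tactic.RingSolver using (solve-∀)
open NaturalBound using (binomial-product-bound; [j+k+v]+[j+k]∸2j≡k+v+k)

-- Without the zero test the solver cannot cancel terms such as y - y.
ℚ-ring : AlmostCommutativeRing 0ℓ 0ℓ
ℚ-ring = fromCommutativeRing +-*-commutativeRing (λ x → dec⇒maybe (0ℚ ≟ x))

fromℕ : ℕ → ℚ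
fromℕ n = (+ n) / 1

-- On the canonical representative fromℤ, _+_ and _*_ compute to a fraction over 1.
fromℕ≡fromℤ : ∀ n → fromℕ n ≡ fromℤ (+ n)
fromℕ≡fromℤ n = ↥p/↧p≡p (fromℤ (+ n))

fromℕ-homo-+ : ∀ m n → fromℕ (m +ℕ n) ≡ fromℕ m + fromℕ n
fromℕ-homo-+ m n = begin
  fromℕ (m +ℕ n)             ≡⟨ cong (_/ 1) (trans (ℤ.pos-+ m n) (sym (cong₂ ℤ._+_ m*1≡m n*1≡n))) ⟩
  fromℤ (+ m) + fromℤ (+ n)  ≡⟨ cong₂ _+_ (fromℕ≡fromℤ m) (fromℕ≡fromℤ n) ⟨
  fromℕ m + fromℕ n          ∎
  where
  open ≡-Reasoning
  m*1≡m = ℤ.*-identityʳ (+ m)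
  n*1≡n = ℤ.*-identityʳ (+ n)

fromℕ-homo-* : ∀ m n → fromℕ (m *ℕ n) ≡ fromℕ m * fromℕ n
fromℕ-homo-* m n = begin
  fromℕ (m *ℕ n)            ≡⟨ cong (_/ 1) (ℤ.pos-* m n) ⟩
  fromℤ (+ m) * fromℤ (+ n)  ≡⟨ cong₂ _*_ (fromℕ≡fromℤ m) (fromℕ≡fromℤ n) ⟨
  fromℕ m * fromℕ n          ∎
  where open ≡-Reasoning

fromℕ-homo-^ : ∀ m n → fromℕ (m ^ℕ n) ≡ fromℕ m ^ℚ n
fromℕ-homo-^ m zero    = refl
fromℕ-homo-^ m (suc n) = trans (fromℕ-homo-* m (m ^ℕ n)) (cong (fromℕ m *_) (fromℕ-homo-^ m n))

fromℕ-mono-≤ : ∀ {m n} → m ≤ n → fromℕ m ≤ℚ fromℕ n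
fromℕ-mono-≤ {m} {n} m≤n = subst₂ _≤ℚ_ (sym (fromℕ≡fromℤ m)) (sym (fromℕ≡fromℤ n))
  (*≤* (ℤ.*-monoʳ-≤-nonNeg (+ 1) (ℤ.+≤+ m≤n)))

i/n*n≡i : ∀ i n .{{_ : NonZero n}} → i / n * fromℕ n ≡ i / 1
i/n*n≡i i n@(suc m) = toℚᵘ-injective (begin
  toℚᵘ (i / n * fromℕ n)
    ≈⟨ toℚᵘ-homo-* (i / n) (fromℕ n) ⟩
  toℚᵘ (i / n) ℚᵘ.* toℚᵘ (fromℕ n)
    ≈⟨ ℚᵘ.*-cong (toℚᵘ-fromℚᵘ (mkℚᵘ i m)) (toℚᵘ-fromℚᵘ (mkℚᵘ (+ n) 0)) ⟩
  mkℚᵘ i m ℚᵘ.* mkℚᵘ (+ n) 0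
    ≈⟨ *≡* (trans (ℤ.*-identityʳ (i ℤ.* + n)) (cong (λ k → i ℤ.* + suc k) (sym (ℕ.*-identityʳ m)))) ⟩
  mkℚᵘ i 0
    ≈⟨ toℚᵘ-fromℚᵘ (mkℚᵘ i 0) ⟨
  toℚᵘ (i / 1) ∎)
  where open ℚᵘ.≃-Reasoning

^ℚ-distrib-* : ∀ p q n → (p * q) ^ℚ n ≡ p ^ℚ n * q ^ℚ n
^ℚ-distrib-* p q zero    = refl
^ℚ-distrib-* p q (suc n) = trans (cong (p * q *_) (^ℚ-distrib-* p q n)) (interchange p q (p ^ℚ n) (q ^ℚ n))
  where
  interchange : ∀ a b c d → a * b * (c * d) ≡ a * c * (b * d)
  interchange = solve-∀ ℚ-ring

[w+d/2+c/2]*2≡2w+d+c : ∀ w d c →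
  (fromℕ w + (+ d) / 2 + (+ c) / 2) * fromℕ 2 ≡ fromℕ (2 *ℕ w +ℕ d +ℕ c)
[w+d/2+c/2]*2≡2w+d+c w d c = begin
  (fromℕ w + (+ d) / 2 + (+ c) / 2) * fromℕ 2
    ≡⟨ distrib (fromℕ w) ((+ d) / 2) ((+ c) / 2) (fromℕ 2) ⟩
  fromℕ 2 * fromℕ w + (+ d) / 2 * fromℕ 2 + (+ c) / 2 * fromℕ 2
    ≡⟨ cong₂ (λ x y → fromℕ 2 * fromℕ w + x + y) (i/n*n≡i (+ d) 2) (i/n*n≡i (+ c) 2) ⟩
  fromℕ 2 * fromℕ w + fromℕ d + fromℕ c
    ≡⟨ cong (λ x → x + fromℕ d + fromℕ c) (fromℕ-homo-* 2 w) ⟨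
  fromℕ (2 *ℕ w) + fromℕ d + fromℕ c
    ≡⟨ cong (_+ fromℕ c) (fromℕ-homo-+ (2 *ℕ w) d) ⟨
  fromℕ (2 *ℕ w +ℕ d) + fromℕ c
    ≡⟨ fromℕ-homo-+ (2 *ℕ w +ℕ d) c ⟨
  fromℕ (2 *ℕ w +ℕ d +ℕ c) ∎
  where
  open ≡-Reasoning
  distrib : ∀ x y z t → (x + y + z) * t ≡ t * x + y * t + z * t
  distrib = solve-∀ ℚ-ring

[w-d/2+c/2]*2≡b : ∀ w d c b → b +ℕ d ≡ 2 *ℕ w +ℕ c →
  (fromℕ w - (+ d) / 2 + (+ c) / 2) * fromℕ 2 ≡ fromℕ b
[w-d/2+c/2]*2≡b w d c b b+d≡2w+c = begin
  (fromℕ w - (+ d) / 2 + (+ c) / 2) * fromℕ 2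
    ≡⟨ distrib (fromℕ w) ((+ d) / 2) ((+ c) / 2) (fromℕ 2) ⟩
  fromℕ 2 * fromℕ w + (+ c) / 2 * fromℕ 2 - (+ d) / 2 * fromℕ 2
    ≡⟨ cong₂ (λ x y → fromℕ 2 * fromℕ w + x - y) (i/n*n≡i (+ c) 2) (i/n*n≡i (+ d) 2) ⟩
  fromℕ 2 * fromℕ w + fromℕ c - fromℕ d
    ≡⟨ cong (λ x → x + fromℕ c - fromℕ d) (fromℕ-homo-* 2 w) ⟨
  fromℕ (2 *ℕ w) + fromℕ c - fromℕ d
    ≡⟨ cong (_- fromℕ d) (fromℕ-homo-+ (2 *ℕ w) c) ⟨
  fromℕ (2 *ℕ w +ℕ c) - fromℕ d
    ≡⟨ cong (λ x → fromℕ x - fromℕ d) b+d≡2w+c ⟨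
  fromℕ (b +ℕ d) - fromℕ d
    ≡⟨ cong (_- fromℕ d) (fromℕ-homo-+ b d) ⟩
  fromℕ b + fromℕ d - fromℕ d
    ≡⟨ cancel (fromℕ b) (fromℕ d) ⟩
  fromℕ b ∎
  where
  open ≡-Reasoning
  distrib : ∀ x y z t → (x - y + z) * t ≡ t * x + z * t - y * t
  distrib = solve-∀ ℚ-ring
  cancel : ∀ x y → x + y - y ≡ x
  cancel = solve-∀ ℚ-ring

p^k*q^j/F*[2^k*2^j*F]≡a^k*b^j : ∀ {p q a b} j k F .{{_ : NonZero F}} →
  p * fromℕ 2 ≡ fromℕ a → q * fromℕ 2 ≡ fromℕ b →
  p ^ℚ k * q ^ℚ j * ((+ 1) / F) * fromℕ (2 ^ℕ k *ℕ 2 ^ℕ j *ℕ F) ≡ fromℕ (a ^ℕ k *ℕ b ^ℕ j)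
p^k*q^j/F*[2^k*2^j*F]≡a^k*b^j {p} {q} {a} {b} j k F 2p≡a 2q≡b = begin
  p ^ℚ k * q ^ℚ j * ((+ 1) / F) * fromℕ (2 ^ℕ k *ℕ 2 ^ℕ j *ℕ F)
    ≡⟨ cong (p ^ℚ k * q ^ℚ j * ((+ 1) / F) *_) fromℕ-scale ⟩
  p ^ℚ k * q ^ℚ j * ((+ 1) / F) * (two ^ℚ k * two ^ℚ j * fromℕ F)
    ≡⟨ rearrange (p ^ℚ k) (q ^ℚ j) ((+ 1) / F) (two ^ℚ k) (two ^ℚ j) (fromℕ F) ⟩
  p ^ℚ k * two ^ℚ k * (q ^ℚ j * two ^ℚ j) * ((+ 1) / F * fromℕ F)
    ≡⟨ cong₂ (λ x y → x * y * ((+ 1) / F * fromℕ F)) (^ℚ-distrib-* p two k) (^ℚ-distrib-* q two j) ⟨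
  (p * two) ^ℚ k * (q * two) ^ℚ j * ((+ 1) / F * fromℕ F)
    ≡⟨ cong₂ _*_ (cong₂ (λ x y → x ^ℚ k * y ^ℚ j) 2p≡a 2q≡b) (i/n*n≡i (+ 1) F) ⟩
  fromℕ a ^ℚ k * fromℕ b ^ℚ j * 1ℚ
    ≡⟨ *-identityʳ _ ⟩
  fromℕ a ^ℚ k * fromℕ b ^ℚ j
    ≡⟨ cong₂ _*_ (fromℕ-homo-^ a k) (fromℕ-homo-^ b j) ⟨
  fromℕ (a ^ℕ k) * fromℕ (b ^ℕ j)
    ≡⟨ fromℕ-homo-* (a ^ℕ k) (b ^ℕ j) ⟨
  fromℕ (a ^ℕ k *ℕ b ^ℕ j) ∎
  where
  open ≡-Reasoning
  two = fromℕ 2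
  fromℕ-scale : fromℕ (2 ^ℕ k *ℕ 2 ^ℕ j *ℕ F) ≡ two ^ℚ k * two ^ℚ j * fromℕ F
  fromℕ-scale = begin
    fromℕ (2 ^ℕ k *ℕ 2 ^ℕ j *ℕ F)
      ≡⟨ fromℕ-homo-* (2 ^ℕ k *ℕ 2 ^ℕ j) F ⟩
    fromℕ (2 ^ℕ k *ℕ 2 ^ℕ j) * fromℕ F
      ≡⟨ cong (_* fromℕ F) (fromℕ-homo-* (2 ^ℕ k) (2 ^ℕ j)) ⟩
    fromℕ (2 ^ℕ k) * fromℕ (2 ^ℕ j) * fromℕ F
      ≡⟨ cong₂ (λ x y → x * y * fromℕ F) (fromℕ-homo-^ 2 k) (fromℕ-homo-^ 2 j) ⟩
    two ^ℚ k * two ^ℚ j * fromℕ F ∎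
  rearrange : ∀ x y i s t f → x * y * i * (s * t * f) ≡ x * s * (y * t) * (i * f)
  rearrange = solve-∀ ℚ-ring

binomial-product-bound-ℚ : ∀ j k v →
  fromℕ ((j +ℕ k +ℕ v) C j) * fromℕ ((k +ℕ v +ℕ k) C k)
    ≤ℚ (fromℕ (j +ℕ k +ℕ v) + (+ (j +ℕ k)) / 2 + (+ 1) / 2) ^ℚ k
       * (fromℕ (j +ℕ k +ℕ v) - (+ (j +ℕ k)) / 2 + (+ 3) / 2) ^ℚ j
       * _/_ (+ 1) (j ! *ℕ k !) {{j !* k !≢0}}
binomial-product-bound-ℚ j k v = *-cancelʳ-≤-pos (fromℕ T) {{normalize-pos T 1}} (begin
  fromℕ Cj * fromℕ Ck * fromℕ T
    ≡⟨ trans (fromℕ-homo-* (Cj *ℕ Ck) T) (cong (_* fromℕ T) (fromℕ-homo-* Cj Ck)) ⟨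
  fromℕ (Cj *ℕ Ck *ℕ T)
    ≤⟨ fromℕ-mono-≤ (binomial-product-bound j k v) ⟩
  fromℕ (A ^ℕ k *ℕ B ^ℕ j)
    ≡⟨ p^k*q^j/F*[2^k*2^j*F]≡a^k*b^j j k F {{j !* k !≢0}} 2P≡A 2Q≡B ⟨
  P ^ℚ k * Q ^ℚ j * _/_ (+ 1) F {{j !* k !≢0}} * fromℕ T ∎)
  where
  open ≤-Reasoning
  w = j +ℕ k +ℕ v
  d = j +ℕ k
  Cj = w C j
  Ck = (k +ℕ v +ℕ k) C k
  F = j ! *ℕ k !
  T = 2 ^ℕ k *ℕ 2 ^ℕ j *ℕ F
  instance
    T≢0 : NonZero T
    T≢0 = ℕ.m*n≢0 _ F {{ℕ.m*n≢0 _ _ {{ℕ.m^n≢0 2 k}} {{ℕ.m^n≢0 2 j}}}} {{j !* k !≢0}}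
  A = 2 *ℕ w +ℕ d +ℕ 1
  B = 2 *ℕ v +ℕ k +ℕ j +ℕ 3
  P = fromℕ w + (+ d) / 2 + (+ 1) / 2
  Q = fromℕ w - (+ d) / 2 + (+ 3) / 2
  2P≡A : P * fromℕ 2 ≡ fromℕ A
  2P≡A = [w+d/2+c/2]*2≡2w+d+c w d 1
  2Q≡B : Q * fromℕ 2 ≡ fromℕ B
  2Q≡B = [w-d/2+c/2]*2≡b w d 3 B (B+d≡2w+3 j k v)
    where
    B+d≡2w+3 : ∀ j k v → 2 *ℕ v +ℕ k +ℕ j +ℕ 3 +ℕ (j +ℕ k) ≡ 2 *ℕ (j +ℕ k +ℕ v) +ℕ 3
    B+d≡2w+3 = ℕ-Solver.solve-∀

lemma5 : (w d j : ℕ) → 1 ≤ d → d ≤ w → j ≤ d →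
    ((+ (w C j)) / 1) * ((+ ((w +ℕ d ∸ 2 *ℕ j) C (d ∸ j))) / 1)
      ≤ℚ ((((+ w) / 1) + ((+ d) / 2) + ((+ 1) / 2)) ^ℚ (d ∸ j))
         * ((((+ w) / 1) - ((+ d) / 2) + ((+ 3) / 2)) ^ℚ j)
         * _/_ (+ 1) (j ! *ℕ (d ∸ j) !) {{j !* (d ∸ j) !≢0}}
lemma5 w d j _ d≤w j≤d with ℕ.m≤n⇒∃[o]m+o≡n j≤d
... | k , refl with ℕ.m≤n⇒∃[o]m+o≡n d≤w
... | v , refl rewrite ℕ.m+n∸m≡n j k | [j+k+v]+[j+k]∸2j≡k+v+k j k v = binomial-product-bound-ℚ j k v
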